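{- Work in the class language $LL$ with the axioms of extensionality and impredicative comprehension, and assume the existence of the natural numbers $\omega$, the pair axiom (for sets $a,b$, $\{a,b\}$ is a set), the union axiom (for a set $s$, $\bigcup s$ is a set), that the universe $V$ of all sets is a paradoxical class, and that there exists an ungrounded set. Then the class $NWF$ of all ungrounded sets is a paradoxical class.
   Context: In $LL$ objects are classes; a class is a set iff it is an element of some class, otherwise it is a paradoxical (proper) class; lower-case variables range over sets. A set $x$ is ungrounded iff there is a sequence of sets $(x_n)_{n\in\omega}$ with $x=x_0\ni x_1\ni x_2\ni\cdots$; otherwise it is grounded. -}

module Defs where

open import Level using (Level; suc)
open import Data.Nat as ℕ using (ℕ)
open import Data.Product using (Σ; _×_; ∃)
open import Data.Sum using (_⊎_)
open import Relation.Binary.PropositionalEquality using (_≡_)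
open import Relation.Nullary using (¬_)
open import Function.Bundles using (_⇔_)

record LL (ℓ : Level) : Set (suc ℓ) where
  field
    Cls : Set ℓ
    _∈_ : Cls → Cls → Set ℓ

module _ {ℓ : Level} (M : LL ℓ) where
  open LL M

  IsSet : Cls → Set ℓ
  IsSet x = Σ Cls λ y → x ∈ y

  Paradoxical : Cls → Set ℓ
  Paradoxical x = ¬ IsSet x

  Extensionality : Set ℓ
  Extensionality = ∀ x y → (∀ z → (z ∈ x) ⇔ (z ∈ y)) → x ≡ y

  -- impredicative comprehension: any (meta-level) property of sets
  -- (which may quantify over all classes) determines a class
  Comprehension : Set (suc ℓ)
  Comprehension = (P : Cls → Set ℓ) →
    Σ Cls λ A → ∀ x → (x ∈ A) ⇔ (IsSet x × P x)

  IsEmpty : Cls → Set ℓ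
  IsEmpty e = ∀ z → ¬ (z ∈ e)

  IsSucc : Cls → Cls → Set ℓ
  IsSucc t x = ∀ z → (z ∈ t) ⇔ (z ∈ x ⊎ z ≡ x)

  OmegaAxiom : Set ℓ
  OmegaAxiom = Σ Cls λ ω → IsSet ω × Σ (ℕ → Cls) λ num →
    IsEmpty (num 0) × (∀ n → IsSucc (num (ℕ.suc n)) (num n)) ×
    (∀ z → (z ∈ ω) ⇔ (∃ λ n → z ≡ num n))

  IsPair : Cls → Cls → Cls → Set ℓ
  IsPair p a b = ∀ z → (z ∈ p) ⇔ (z ≡ a ⊎ z ≡ b)

  PairAxiom : Set ℓ
  PairAxiom = ∀ a b → IsSet a → IsSet b →
    Σ Cls λ p → IsSet p × IsPair p a b

  IsUnion : Cls → Cls → Set ℓ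
  IsUnion u s = ∀ z → (z ∈ u) ⇔ (Σ Cls λ y → z ∈ y × y ∈ s)

  UnionAxiom : Set ℓ
  UnionAxiom = ∀ s → IsSet s → Σ Cls λ u → IsSet u × IsUnion u s

  IsUniverse : Cls → Set ℓ
  IsUniverse V = ∀ z → (z ∈ V) ⇔ IsSet z

  Ungrounded : Cls → Set ℓ
  Ungrounded x = IsSet x × Σ (ℕ → Cls) λ s →
    s 0 ≡ x × (∀ n → IsSet (s n) × (s (ℕ.suc n) ∈ s n))

  IsNWF : Cls → Set ℓ
  IsNWF N = ∀ z → (z ∈ N) ⇔ Ungrounded z

-- If NWF were a set, so would be its union. But every set z lies in the pair
-- {z, w} with w ungrounded, and that pair is itself ungrounded, so the union of
-- NWF contains every set: it would be the universe V, which is paradoxical.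
module Submission where

open import Defs
open import Level using (Level)
open import Data.Product using (Σ; _,_; proj₁; proj₂; _×_)
open import Data.Sum using (inj₁; inj₂)
open import Data.Nat using (ℕ; zero; suc)
open import Function.Bundles using (Equivalence; mk⇔)
open import Relation.Binary.PropositionalEquality using (refl)

module _ {ℓ : Level} (M : LL ℓ) where
  open LL M

  ∋-ungrounded⇒ungrounded : ∀ {p w} → IsSet M p → w ∈ p → Ungrounded M w →
                            Ungrounded M p
  ∋-ungrounded⇒ungrounded {p} p-set w∈p (_ , s , s₀≡w , s-chain) =
    p-set , t , refl , t-chain
    where
    t : ℕ → Cls
    t zero    = p
    t (suc n) = s n

    t-chain : ∀ n → IsSet M (t n) × (t (suc n) ∈ t n)
    t-chain zero    rewrite s₀≡w = p-set , w∈p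
    t-chain (suc n) = s-chain n

  set-∈-ungrounded : PairAxiom M → Σ Cls (Ungrounded M) →
                     ∀ z → IsSet M z → Σ Cls λ p → z ∈ p × Ungrounded M p
  set-∈-ungrounded pair (w , w-ungr@(w-set , _)) z z-set =
    p , z∈p , ∋-ungrounded⇒ungrounded p-set w∈p w-ungr
    where
    p = proj₁ (pair z w z-set w-set)
    p-set = proj₁ (proj₂ (pair z w z-set w-set))
    p-pair = proj₂ (proj₂ (pair z w z-set w-set))

    z∈p : z ∈ p
    z∈p = Equivalence.from (p-pair z) (inj₁ refl)

    w∈p : w ∈ p
    w∈p = Equivalence.from (p-pair w) (inj₂ refl)

  union-universe : ∀ {u s} → IsUnion M u s →
                   (∀ z → IsSet M z → Σ Cls λ y → z ∈ y × y ∈ s) →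
                   IsUniverse M u
  union-universe {u} u-union covers z = mk⇔ member⇒set set⇒member
    where
    member⇒set : z ∈ u → IsSet M z
    member⇒set z∈u with Equivalence.to (u-union z) z∈u
    ... | y , z∈y , _ = y , z∈y

    set⇒member : IsSet M z → z ∈ u
    set⇒member z-set = Equivalence.from (u-union z) (covers z z-set)

mainTheorem8 : {ℓ : Level} (M : LL ℓ) →
    Extensionality M → Comprehension M → OmegaAxiom M →
    PairAxiom M → UnionAxiom M →
    (∀ V → IsUniverse M V → Paradoxical M V) →
    Σ (LL.Cls M) (Ungrounded M) →
    ∀ N → IsNWF M N → Paradoxical M N
mainTheorem8 M _ _ _ pair union V-paradoxical ungrounded N N-nwf N-set =
  V-paradoxical ⋃N ⋃N-universe ⋃N-set
  where
  open LL M

  ⋃N = proj₁ (union N N-set)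
  ⋃N-set = proj₁ (proj₂ (union N N-set))

  ⋃N-universe : IsUniverse M ⋃N
  ⋃N-universe = union-universe M (proj₂ (proj₂ (union N N-set))) λ z z-set →
    let p , z∈p , p-ungr = set-∈-ungrounded M pair ungrounded z z-set
    in  p , z∈p , Equivalence.from (N-nwf p) p-ungr
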